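{- Let $D=(X,\mathcal{B})$ be a symmetric $2$-$(v,k,\lambda)$ design, let $B_0\in\mathcal{B}$ and let $D_1=\mathrm{Res}(X,\mathcal{B},B_0)$. Then $\gamma(D_1)\geq \gamma(D)-1$.
   Context: Let $v,k,\lambda$ be positive integers with $v\geq k\geq 2$. A $2$-$(v,k,\lambda)$ design $D=(X,\mathcal{B})$ consists of a set $X$ of $v$ points and a family $\mathcal{B}$ of $k$-subsets of $X$ (blocks) such that every pair of distinct points is contained in exactly $\lambda$ blocks; $D$ is symmetric if $|\mathcal{B}|=v$. For a symmetric design and $B_0\in\mathcal{B}$, the residual design is $\mathrm{Res}(X,\mathcal{B},B_0)=(X\setminus B_0,\{B\setminus B_0: B\in\mathcal{B}, B\neq B_0\})$. For such an incidence structure, the incidence graph is the bipartite graph on points and blocks with $x$ adjacent to $B$ iff $x\in B$; a dominating set of a graph is a set $S$ of vertices such that every vertex not in $S$ is adjacent to some vertex of $S$; $\gamma(\cdot)$ is the minimum size of a dominating set of the incidence graph. -}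

module Defs where

open import Data.Nat using (ℕ; _+_; _≤_)
open import Data.Bool using (_∧_)
open import Data.Fin using (Fin)
open import Data.Fin.Subset using (Subset; _∈_; _∉_; _⊆_; ∣_∣; ⁅_⁆; ∁; ⊤)
open import Data.Vec using (lookup; tabulate)
open import Data.Product using (Σ; ∃-syntax; _×_)
open import Relation.Binary.PropositionalEquality using (_≡_; _≢_)

-- Designs.  Points are Fin v; a block family with b blocks is an indexed
-- family  Fin b → Subset v  (repeated blocks allowed).  A symmetric
-- design has exactly v blocks.

blocksThrough : ∀ {v b} → (Fin b → Subset v) → Fin v → Fin v → Subset b
blocksThrough B x y = tabulate (λ i → lookup (B i) x ∧ lookup (B i) y)

Is2Design : (v k λ' b : ℕ) → (Fin b → Subset v) → Set
Is2Design v k λ' b B =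
  (∀ i → ∣ B i ∣ ≡ k) ×
  (∀ x y → x ≢ y → ∣ blocksThrough B x y ∣ ≡ λ')

IsSymmetric2Design : (v k λ' : ℕ) → (Fin v → Subset v) → Set
IsSymmetric2Design v k λ' B = Is2Design v k λ' v B

record IncidenceStructure : Set₁ where
  field
    nP nB  : ℕ
    points : Subset nP
    blocks : Subset nB
    _I_    : Fin nP → Fin nB → Set

record DominatingSet (S : IncidenceStructure) : Set where
  open IncidenceStructure S
  field
    SP   : Subset nP
    SB   : Subset nB
    SP⊆  : SP ⊆ points
    SB⊆  : SB ⊆ blocks
    domP : ∀ x → x ∈ points → x ∉ SP → ∃[ j ] (j ∈ SB × x I j)
    domB : ∀ j → j ∈ blocks → j ∉ SB → ∃[ x ] (x ∈ SP × x I j)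

  size : ℕ
  size = ∣ SP ∣ + ∣ SB ∣

IsDominationNumber : IncidenceStructure → ℕ → Set
IsDominationNumber S g =
  (Σ (DominatingSet S) (λ D → DominatingSet.size D ≡ g)) ×
  (∀ (D : DominatingSet S) → g ≤ DominatingSet.size D)

designStructure : ∀ {v b} → (Fin b → Subset v) → IncidenceStructure
designStructure {v} {b} B = record
  { nP = v ; nB = b ; points = ⊤ ; blocks = ⊤ ; _I_ = λ x j → x ∈ B j }

-- Res(X, 𝓑, B i₀): points X ∖ B i₀, blocks B j ∖ B i₀ for j ≠ i₀;
-- a point x ∉ B i₀ lies on B j ∖ B i₀ iff x ∈ B j.
residual : ∀ {v} → (Fin v → Subset v) → Fin v → IncidenceStructure
residual {v} B i₀ = record
  { nP = v ; nB = v ; points = ∁ (B i₀) ; blocks = ∁ ⁅ i₀ ⁆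
  ; _I_ = λ x j → x ∈ B j }

-- Adding the removed block B₀ to a dominating set of the residual design
-- gives a dominating set of D: B₀ dominates the points of B₀, and all other
-- points and blocks are already dominated inside the residual.
module Submission where

open import Defs
open import Data.Nat using (ℕ; _≤_; _∸_; _+_; suc; s≤s; z≤n)
open import Data.Nat.Properties
  using (≤-reflexive; ≤-trans; n≤1+n; +-suc; +-monoʳ-≤; ∸-monoˡ-≤; module ≤-Reasoning)
open import Data.Fin using (Fin)
open import Data.Fin.Subset
open import Data.Fin.Subset.Properties
  using (_∈?_; ∈⊤; x∈⁅x⁆; x∈p∪q⁺; x∉p⇒x∈∁p; ∣⁅x⁆∣≡1)
open import Data.Bool using (true; false)
open import Data.Vec using (_∷_; [])
open import Data.Sum using (inj₁; inj₂)
open import Data.Product using (_,_; _×_; ∃-syntax)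
open import Relation.Nullary using (yes; no)
open import Relation.Binary.PropositionalEquality using (cong)

∣p∪q∣≤∣p∣+∣q∣ : ∀ {n} (p q : Subset n) → ∣ p ∪ q ∣ ≤ ∣ p ∣ + ∣ q ∣
∣p∪q∣≤∣p∣+∣q∣ []          []          = z≤n
∣p∪q∣≤∣p∣+∣q∣ (false ∷ p) (false ∷ q) = ∣p∪q∣≤∣p∣+∣q∣ p q
∣p∪q∣≤∣p∣+∣q∣ (true  ∷ p) (false ∷ q) = s≤s (∣p∪q∣≤∣p∣+∣q∣ p q)
∣p∪q∣≤∣p∣+∣q∣ (false ∷ p) (true  ∷ q) = begin
  suc ∣ p ∪ q ∣       ≤⟨ s≤s (∣p∪q∣≤∣p∣+∣q∣ p q) ⟩
  suc (∣ p ∣ + ∣ q ∣) ≡⟨ +-suc ∣ p ∣ ∣ q ∣ ⟨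
  ∣ p ∣ + suc ∣ q ∣   ∎
  where open ≤-Reasoning
∣p∪q∣≤∣p∣+∣q∣ (true  ∷ p) (true  ∷ q) =
  s≤s (≤-trans (∣p∪q∣≤∣p∣+∣q∣ p q) (+-monoʳ-≤ ∣ p ∣ (n≤1+n ∣ q ∣)))

∣⁅i⁆∪p∣≤1+∣p∣ : ∀ {n} (i : Fin n) (p : Subset n) → ∣ ⁅ i ⁆ ∪ p ∣ ≤ suc ∣ p ∣
∣⁅i⁆∪p∣≤1+∣p∣ i p =
  ≤-trans (∣p∪q∣≤∣p∣+∣q∣ ⁅ i ⁆ p) (≤-reflexive (cong (_+ ∣ p ∣) (∣⁅x⁆∣≡1 i)))

module _ {v} (B : Fin v → Subset v) (i₀ : Fin v) where

  addRemovedBlock : DominatingSet (residual B i₀) → DominatingSet (designStructure B)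
  addRemovedBlock D = record
    { SP = SP ; SB = ⁅ i₀ ⁆ ∪ SB ; SP⊆ = λ _ → ∈⊤ ; SB⊆ = λ _ → ∈⊤
    ; domP = dominatesPoints ; domB = dominatesBlocks }
    where
    open DominatingSet D
    dominatesPoints : ∀ x → x ∈ ⊤ → x ∉ SP → ∃[ j ] (j ∈ ⁅ i₀ ⁆ ∪ SB × x ∈ B j)
    dominatesPoints x _ x∉SP with x ∈? B i₀
    ... | yes x∈B₀ = i₀ , x∈p∪q⁺ (inj₁ (x∈⁅x⁆ i₀)) , x∈B₀
    ... | no  x∉B₀ with domP x (x∉p⇒x∈∁p x∉B₀) x∉SP
    ...   | j , j∈SB , x∈Bj = j , x∈p∪q⁺ (inj₂ j∈SB) , x∈Bj
    dominatesBlocks : ∀ j → j ∈ ⊤ → j ∉ ⁅ i₀ ⁆ ∪ SB → ∃[ x ] (x ∈ SP × x ∈ B j)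
    dominatesBlocks j _ j∉ =
      domB j (x∉p⇒x∈∁p (λ j≡i₀ → j∉ (x∈p∪q⁺ (inj₁ j≡i₀))))
             (λ j∈SB → j∉ (x∈p∪q⁺ (inj₂ j∈SB)))

  size-addRemovedBlock : (D : DominatingSet (residual B i₀)) →
    DominatingSet.size (addRemovedBlock D) ≤ suc (DominatingSet.size D)
  size-addRemovedBlock D = begin
    ∣ SP ∣ + ∣ ⁅ i₀ ⁆ ∪ SB ∣ ≤⟨ +-monoʳ-≤ ∣ SP ∣ (∣⁅i⁆∪p∣≤1+∣p∣ i₀ SB) ⟩
    ∣ SP ∣ + suc ∣ SB ∣     ≡⟨ +-suc ∣ SP ∣ ∣ SB ∣ ⟩
    suc (∣ SP ∣ + ∣ SB ∣)   ∎
    where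
    open DominatingSet D
    open ≤-Reasoning

  γ≤1+γ-residual : ∀ {g g₁} → IsDominationNumber (designStructure B) g →
    IsDominationNumber (residual B i₀) g₁ → g ≤ suc g₁
  γ≤1+γ-residual {g} {g₁} (_ , g-minimal) ((D₁ , size-D₁≡g₁) , _) = begin
    g                                        ≤⟨ g-minimal (addRemovedBlock D₁) ⟩
    DominatingSet.size (addRemovedBlock D₁) ≤⟨ size-addRemovedBlock D₁ ⟩
    suc (DominatingSet.size D₁)              ≡⟨ cong suc size-D₁≡g₁ ⟩
    suc g₁                                   ∎
    where open ≤-Reasoning

theorem5p2 : (v k λ' : ℕ) → 2 ≤ k → k ≤ v → 1 ≤ λ' →
    (B : Fin v → Subset v) → IsSymmetric2Design v k λ' B →
    (i₀ : Fin v) → (g g₁ : ℕ) →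
    IsDominationNumber (designStructure B) g →
    IsDominationNumber (residual B i₀) g₁ →
    g ∸ 1 ≤ g₁
theorem5p2 _ _ _ _ _ _ B _ i₀ _ _ γ γ₁ = ∸-monoˡ-≤ 1 (γ≤1+γ-residual B i₀ γ γ₁)
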